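{- For $n\ge 1$ let $\alpha_n$ be the number of permutations $w\in S_n$ that avoid each of the patterns $[321]$, $[2143]$, $[3142]$, $[2413]$, $[3412]$. Then $\alpha_n=(n-1)^2+1$ for all $n\ge 1$. In particular $\alpha_{n+1}=3\alpha_n-3\alpha_{n-1}+\alpha_{n-2}$ for all $n\ge 3$.
   Context: Permutations are in one-line notation $[w_1,\dots,w_n]$. $w\in S_n$ contains $v\in S_k$ if there are indices $i_1<\dots<i_k$ with $w_{i_j}<w_{i_m}$ exactly when $v_j<v_m$; otherwise $w$ avoids $v$. -}

module Defs where

open import Data.Nat using (ℕ; zero; suc; _+_; _*_; _∸_)
open import Data.Fin using (Fin; _<_; _<?_)
open import Data.Vec using (Vec; []; _∷_; lookup)
open import Data.List using (List; []; _∷_; concatMap; map; length; filter)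
open import Data.List.Relation.Unary.All using (All)
open import Data.Product using (Σ; _×_; _,_)
open import Relation.Nullary using (¬_; Dec; yes; no)
open import Relation.Nullary.Decidable using (_×-dec_; ¬?)
open import Relation.Binary.PropositionalEquality using (_≡_)
open import Function using (_⇔_)
import Data.Fin.Properties as FinP

-- A word of length n over letters Fin n, in one-line notation: w_i = lookup w i.
-- A permutation of S_n (0-based values) is such a word that is injective.
IsPerm : ∀ {n} → Vec (Fin n) n → Set
IsPerm {n} w = ∀ (i j : Fin n) → lookup w i ≡ lookup w j → i ≡ j

Contains : ∀ {n k} → Vec (Fin n) n → Vec (Fin k) k → Set
Contains {n} {k} w v =
  Σ (Fin k → Fin n) λ ι →
    (∀ (j m : Fin k) → j < m → ι j < ι m) ×
    (∀ (j m : Fin k) → (lookup w (ι j) < lookup w (ι m)) ⇔ (lookup v j < lookup v m))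

Avoids : ∀ {n k} → Vec (Fin n) n → Vec (Fin k) k → Set
Avoids w v = ¬ Contains w v

-- The five patterns, written 0-based: [321], [2143], [3142], [2413], [3412].
open import Data.Fin using (zero; suc)
p321 : Vec (Fin 3) 3
p321 = suc (suc zero) ∷ suc zero ∷ zero ∷ []
p2143 p3142 p2413 p3412 : Vec (Fin 4) 4
p2143 = suc zero ∷ zero ∷ suc (suc (suc zero)) ∷ suc (suc zero) ∷ []
p3142 = suc (suc zero) ∷ zero ∷ suc (suc (suc zero)) ∷ suc zero ∷ []
p2413 = suc zero ∷ suc (suc (suc zero)) ∷ zero ∷ suc (suc zero) ∷ []
p3412 = suc (suc zero) ∷ suc (suc (suc zero)) ∷ zero ∷ suc zero ∷ []

AvoidsAll : ∀ {n} → Vec (Fin n) n → Set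
AvoidsAll w = Avoids w p321 × Avoids w p2143 × Avoids w p3142 × Avoids w p2413 × Avoids w p3412

Good : ∀ {n} → Vec (Fin n) n → Set
Good w = IsPerm w × AvoidsAll w

-- α n = k  means: the set of Good w ∈ S_n has exactly k elements, witnessed by
-- a duplicate-free list enumerating exactly the Good vectors.
open import Data.List.Relation.Unary.Unique.Propositional using (Unique)
open import Data.List.Membership.Propositional using (_∈_)

HasCount : ℕ → ℕ → Set
HasCount n k = Σ (List (Vec (Fin n) n)) λ ws →
  Unique ws × (∀ w → w ∈ ws ⇔ Good w) × length ws ≡ k

-- A permutation avoiding the five patterns is the identity or the identity with one
-- block of consecutive positions lo … hi rotated by one step.  Such a rotation avoids
-- them because all its inversions share a position, whereas the three inversions of
-- 321 share none and each of 2143, 3142, 2413, 3412 has two disjoint inversions.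
-- Conversely, if i is the first moved position and p the position of the value i,
-- avoidance forces either w(i) = i+1, and then w rotates i … p to the left, or
-- p = i+1, and then w rotates i … w(i) to the right; otherwise a 321 or a 3412
-- appears.  There are n(n-1)/2 left and (n-1)(n-2)/2 right rotations, hence
-- (n-1)² + 1 permutations, and the recurrence is a polynomial identity.

module Submission where

open import Defs
open import Data.Nat using (ℕ; zero; suc; pred; _+_; _*_; _∸_; _<_; _≤_; _≥_; _<?_; _≤?_; _≟_; z≤n; s≤s; z<s; s<s)
open import Data.Nat.Properties
open import Data.Nat.Induction using (<-rec)
open import Data.Nat.Tactic.RingSolver using (solve-∀)
open import Data.Fin using (Fin; toℕ; fromℕ<; punchOut) renaming (zero to fzero; suc to fsuc)
import Data.Fin as Fin
open import Data.Fin.Properties using (toℕ-injective; toℕ<n; toℕ-fromℕ<; fromℕ<-toℕ; any?; punchOut-injective; injective⇒≤)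
  renaming (_≟_ to _≟ᶠ_)
open import Data.Vec as Vec using (Vec; []; _∷_; lookup; tabulate)
open import Data.Vec.Properties using (lookup-map; lookup∘tabulate; tabulate∘lookup; tabulate-cong)
open import Data.Vec.Relation.Unary.All as VecAll using ([]; _∷_)
import Data.Vec.Relation.Unary.All.Properties as VecAll
open import Data.Vec.Relation.Unary.Linked using (Linked; [-]; _∷_)
open import Data.Vec.Relation.Unary.Linked.Properties using () renaming (lookup⁺ to Linked-lookup⁺)
open import Data.List using (List; []; _∷_; _++_; map; length; upTo)
open import Data.List.Properties using (length-++; length-map; length-upTo; length-removeAt′)
open import Data.List.Relation.Unary.All as All using (All; []; _∷_)
import Data.List.Relation.Unary.All.Properties as All
open import Data.List.Relation.Unary.Any using (here; there; index)
open import Data.List.Relation.Unary.AllPairs using ([]; _∷_)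
open import Data.List.Relation.Unary.Unique.Propositional using (Unique)
import Data.List.Relation.Unary.Unique.Propositional.Properties as Unique
open import Data.List.Membership.Propositional using (_∈_; _∉_; _─_)
open import Data.List.Membership.Propositional.Properties
  using (∈-map⁺; ∈-map⁻; ∈-++⁺ˡ; ∈-++⁺ʳ; ∈-++⁻; ∈-upTo⁺; ∈-upTo⁻)
open import Data.Product using (∃; _×_; _,_; proj₁; proj₂)
open import Data.Sum using (_⊎_; inj₁; inj₂)
open import Data.Empty using (⊥; ⊥-elim)
open import Function using (_⇔_; mk⇔; Equivalence; case_of_)
open import Relation.Nullary using (¬_; yes; no; contradiction)
open import Relation.Binary using (tri<; tri≈; tri>)
open import Relation.Binary.PropositionalEquality
  using (_≡_; _≢_; refl; sym; trans; cong; cong₂; subst; subst₂; ≢-sym; module ≡-Reasoning)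

private
  variable
    lo hi k n x y : ℕ

-- Rotations of a block

rotateˡ : ℕ → ℕ → ℕ → ℕ
rotateˡ lo hi k with k <? lo
... | yes _ = k
... | no _ with k <? hi
...   | yes _ = suc k
...   | no _ with k ≟ hi
...     | yes _ = lo
...     | no _ = k

rotateʳ : ℕ → ℕ → ℕ → ℕ
rotateʳ lo hi k with k <? lo
... | yes _ = k
... | no _ with k ≟ lo
...   | yes _ = hi
...   | no _ with k ≤? hi
...     | yes _ = pred k
...     | no _ = k

data RotateˡView (lo hi : ℕ) : ℕ → ℕ → Set where
  below  : k < lo → RotateˡView lo hi k k
  inside : lo ≤ k → k < hi → RotateˡView lo hi k (suc k)
  last   : RotateˡView lo hi hi lo
  above  : hi < k → RotateˡView lo hi k k

rotateˡ-view : ∀ lo hi k → RotateˡView lo hi k (rotateˡ lo hi k)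
rotateˡ-view lo hi k with k <? lo
... | yes k<lo = below k<lo
... | no k≮lo with k <? hi
...   | yes k<hi = inside (≮⇒≥ k≮lo) k<hi
...   | no k≮hi with k ≟ hi
...     | yes refl = last
...     | no k≢hi = above (≤∧≢⇒< (≮⇒≥ k≮hi) (≢-sym k≢hi))

data RotateʳView (lo hi : ℕ) : ℕ → ℕ → Set where
  below  : k < lo → RotateʳView lo hi k k
  first  : RotateʳView lo hi lo hi
  inside : lo ≤ k → k < hi → RotateʳView lo hi (suc k) k
  above  : hi < k → RotateʳView lo hi k k

insideʳ : lo < k → k ≤ hi → RotateʳView lo hi k (pred k)
insideʳ (s≤s lo≤k) k≤hi = inside lo≤k k≤hi

rotateʳ-view : ∀ lo hi k → RotateʳView lo hi k (rotateʳ lo hi k)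
rotateʳ-view lo hi k with k <? lo
... | yes k<lo = below k<lo
... | no k≮lo with k ≟ lo
...   | yes refl = first
...   | no k≢lo with k ≤? hi
...     | yes k≤hi = insideʳ (≤∧≢⇒< (≮⇒≥ k≮lo) (≢-sym k≢lo)) k≤hi
...     | no k≰hi = above (≰⇒> k≰hi)

rotateˡ-below : k < lo → rotateˡ lo hi k ≡ k
rotateˡ-below {k} {lo} k<lo with k <? lo
... | yes _ = refl
... | no k≮lo = contradiction k<lo k≮lo

rotateˡ-inside : lo ≤ k → k < hi → rotateˡ lo hi k ≡ suc k
rotateˡ-inside {lo} {k} {hi} lo≤k k<hi with k <? lo
... | yes k<lo = contradiction lo≤k (<⇒≱ k<lo)
... | no _ with k <? hi
...   | yes _ = refl
...   | no k≮hi = contradiction k<hi k≮hi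

rotateˡ-last : lo < hi → rotateˡ lo hi hi ≡ lo
rotateˡ-last {lo} {hi} lo<hi with rotateˡ lo hi hi | rotateˡ-view lo hi hi
... | _ | below hi<lo = contradiction lo<hi (<⇒≯ hi<lo)
... | _ | inside _ hi<hi = contradiction hi<hi (n≮n hi)
... | _ | last = refl
... | _ | above hi<hi = contradiction hi<hi (n≮n hi)

rotateˡ-above : hi < k → rotateˡ lo hi k ≡ k
rotateˡ-above {hi} {k} {lo} hi<k with rotateˡ lo hi k | rotateˡ-view lo hi k
... | _ | below _ = refl
... | _ | inside _ k<hi = contradiction hi<k (<⇒≯ k<hi)
... | _ | last = contradiction hi<k (n≮n hi)
... | _ | above _ = refl

rotateʳ-below : k < lo → rotateʳ lo hi k ≡ k
rotateʳ-below {k} {lo} k<lo with k <? lo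
... | yes _ = refl
... | no k≮lo = contradiction k<lo k≮lo

rotateʳ-first : rotateʳ lo hi lo ≡ hi
rotateʳ-first {lo} with lo <? lo
... | yes lo<lo = contradiction lo<lo (n≮n lo)
... | no _ with lo ≟ lo
...   | yes _ = refl
...   | no lo≢lo = contradiction refl lo≢lo

rotateʳ-inside : lo ≤ k → k < hi → rotateʳ lo hi (suc k) ≡ k
rotateʳ-inside {lo} {k} {hi} lo≤k k<hi with rotateʳ lo hi (suc k) | rotateʳ-view lo hi (suc k)
... | _ | below k<lo = contradiction lo≤k (<⇒≱ (<-trans (n<1+n k) k<lo))
... | _ | first = contradiction lo≤k (n≮n k)
... | _ | inside _ _ = refl
... | _ | above hi<k = contradiction k<hi (<⇒≱ hi<k)

rotateʳ-above : lo < hi → hi < k → rotateʳ lo hi k ≡ k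
rotateʳ-above {lo} {hi} {k} lo<hi hi<k with rotateʳ lo hi k | rotateʳ-view lo hi k
... | _ | below _ = refl
... | _ | first = contradiction lo<hi (<⇒≯ hi<k)
... | _ | inside _ m<hi = contradiction hi<k (≤⇒≯ m<hi)
... | _ | above _ = refl

rotateʳ-rotateˡ : lo < hi → ∀ k → rotateʳ lo hi (rotateˡ lo hi k) ≡ k
rotateʳ-rotateˡ {lo} {hi} lo<hi k with rotateˡ lo hi k | rotateˡ-view lo hi k
... | _ | below k<lo = rotateʳ-below {hi = hi} k<lo
... | _ | inside lo≤k k<hi = rotateʳ-inside lo≤k k<hi
... | _ | last = rotateʳ-first {lo = lo}
... | _ | above hi<k = rotateʳ-above lo<hi hi<k

rotateˡ-rotateʳ : lo < hi → ∀ k → rotateˡ lo hi (rotateʳ lo hi k) ≡ k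
rotateˡ-rotateʳ {lo} {hi} lo<hi k with rotateʳ lo hi k | rotateʳ-view lo hi k
... | _ | below k<lo = rotateˡ-below {hi = hi} k<lo
... | _ | first = rotateˡ-last lo<hi
... | _ | inside lo≤k k<hi = rotateˡ-inside lo≤k k<hi
... | _ | above hi<k = rotateˡ-above {lo = lo} hi<k

rotateˡ-< : lo < hi → hi < n → k < n → rotateˡ lo hi k < n
rotateˡ-< {lo} {hi} {n} {k} lo<hi hi<n k<n with rotateˡ lo hi k | rotateˡ-view lo hi k
... | _ | below _ = k<n
... | _ | inside _ k<hi = ≤-<-trans k<hi hi<n
... | _ | last = <-trans lo<hi hi<n
... | _ | above _ = k<n

rotateʳ-< : hi < n → k < n → rotateʳ lo hi k < n
rotateʳ-< {hi} {n} {k} {lo} hi<n k<n with rotateʳ lo hi k | rotateʳ-view lo hi k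
... | _ | below _ = k<n
... | _ | first = hi<n
... | _ | inside _ _ = <-trans (n<1+n _) k<n
... | _ | above _ = k<n

rotateˡ-near : k ≢ hi → k ≤ rotateˡ lo hi k × rotateˡ lo hi k ≤ suc k
rotateˡ-near {k} {hi} {lo} k≢hi with rotateˡ lo hi k | rotateˡ-view lo hi k
... | _ | below _ = ≤-refl , n≤1+n k
... | _ | inside _ _ = n≤1+n k , ≤-refl
... | _ | last = contradiction refl k≢hi
... | _ | above _ = ≤-refl , n≤1+n k

rotateʳ-near : k ≢ lo → rotateʳ lo hi k ≤ k × k ≤ suc (rotateʳ lo hi k)
rotateʳ-near {k} {lo} {hi} k≢lo with rotateʳ lo hi k | rotateʳ-view lo hi k
... | _ | below _ = ≤-refl , n≤1+n k
... | _ | first = contradiction refl k≢lo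
... | _ | inside _ _ = n≤1+n _ , ≤-refl
... | _ | above _ = ≤-refl , n≤1+n k

data Dir : Set where
  left right : Dir

data Shape : Set where
  identity : Shape
  rotate   : Dir → (lo hi : ℕ) → Shape

⟦_⟧ : Shape → ℕ → ℕ
⟦ identity ⟧ k = k
⟦ rotate left lo hi ⟧ = rotateˡ lo hi
⟦ rotate right lo hi ⟧ = rotateʳ lo hi

-- A right rotation of a two-element block is the left one, so right rotations are
-- only taken on blocks of length at least three.
data Valid (n : ℕ) : Shape → Set where
  identity : Valid n identity
  left     : lo < hi → hi < n → Valid n (rotate left lo hi)
  right    : suc lo < hi → hi < n → Valid n (rotate right lo hi)

InversionsThrough : (ℕ → ℕ) → ℕ → Set
InversionsThrough f e = ∀ {x y} → x < y → f y < f x → x ≡ e ⊎ y ≡ e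

private
  variable
    c c' : Shape
    d d' : Dir

⟦⟧-< : Valid n c → k < n → ⟦ c ⟧ k < n
⟦⟧-< identity k<n = k<n
⟦⟧-< (left lo<hi hi<n) = rotateˡ-< lo<hi hi<n
⟦⟧-< (right {lo = lo} _ hi<n) = rotateʳ-< {lo = lo} hi<n

lo<hi : Valid n (rotate d lo hi) → lo < hi
lo<hi (left lo<hi _) = lo<hi
lo<hi (right 1+lo<hi _) = <-trans (n<1+n _) 1+lo<hi

hi<n : Valid n (rotate d lo hi) → hi < n
hi<n (left _ hi<n) = hi<n
hi<n (right _ hi<n) = hi<n

lo<n : Valid n (rotate d lo hi) → lo < n
lo<n v = <-trans (lo<hi v) (hi<n v)

⟦⟧-injective : Valid n c → ⟦ c ⟧ x ≡ ⟦ c ⟧ y → x ≡ y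
⟦⟧-injective identity eq = eq
⟦⟧-injective {x = x} {y} (left {lo} {hi} lo<hi _) eq =
  trans (sym (rotateʳ-rotateˡ lo<hi x)) (trans (cong (rotateʳ lo hi) eq) (rotateʳ-rotateˡ lo<hi y))
⟦⟧-injective {x = x} {y} v@(right {lo} {hi} _ _) eq =
  trans (sym (rotateˡ-rotateʳ (lo<hi v) x)) (trans (cong (rotateˡ lo hi) eq) (rotateˡ-rotateʳ (lo<hi v) y))

inversionsThrough : ∀ {f e} → (∀ {x y} → x < y → x ≢ e → y ≢ e → f x ≤ f y) → InversionsThrough f e
inversionsThrough {e = e} mono {x} {y} x<y fy<fx with x ≟ e | y ≟ e
... | yes x≡e | _ = inj₁ x≡e
... | no _ | yes y≡e = inj₂ y≡e
... | no x≢e | no y≢e = contradiction (mono x<y x≢e y≢e) (<⇒≱ fy<fx)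

⟦⟧-inversionsThrough : ∀ c → ∃ (InversionsThrough ⟦ c ⟧)
⟦⟧-inversionsThrough identity = 0 , inversionsThrough (λ x<y _ _ → <⇒≤ x<y)
⟦⟧-inversionsThrough (rotate left lo hi) = hi , inversionsThrough λ {x} {y} x<y x≢hi y≢hi →
  ≤-trans (proj₂ (rotateˡ-near {lo = lo} x≢hi)) (≤-trans x<y (proj₁ (rotateˡ-near {lo = lo} y≢hi)))
⟦⟧-inversionsThrough (rotate right lo hi) = lo , inversionsThrough λ {x} {y} x<y x≢lo y≢lo →
  ≤-pred (≤-trans (s≤s (proj₁ (rotateʳ-near {hi = hi} x≢lo))) (≤-trans x<y (proj₂ (rotateʳ-near {hi = hi} y≢lo))))

rotate-fixes-below : Valid n (rotate d lo hi) → k < lo → ⟦ rotate d lo hi ⟧ k ≡ k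
rotate-fixes-below (left {hi = hi} _ _) = rotateˡ-below {hi = hi}
rotate-fixes-below (right {hi = hi} _ _) = rotateʳ-below {hi = hi}

rotate-fixes-above : Valid n (rotate d lo hi) → hi < k → ⟦ rotate d lo hi ⟧ k ≡ k
rotate-fixes-above (left {lo} _ _) = rotateˡ-above {lo = lo}
rotate-fixes-above v@(right _ _) = rotateʳ-above (lo<hi v)

rotate-moves-lo : Valid n (rotate d lo hi) → ⟦ rotate d lo hi ⟧ lo ≢ lo
rotate-moves-lo (left lo<hi _) eq = 1+n≢n (trans (sym (rotateˡ-inside ≤-refl lo<hi)) eq)
rotate-moves-lo v@(right {lo} _ _) eq = <⇒≢ (lo<hi v) (sym (trans (sym (rotateʳ-first {lo = lo})) eq))

rotate-moves-hi : Valid n (rotate d lo hi) → ⟦ rotate d lo hi ⟧ hi ≢ hi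
rotate-moves-hi (left lo<hi _) eq = <⇒≢ lo<hi (trans (sym (rotateˡ-last lo<hi)) eq)
rotate-moves-hi (right {hi = suc m} (s≤s lo<m) _) eq =
  1+n≢n (sym (trans (sym (rotateʳ-inside (<⇒≤ lo<m) (n<1+n m))) eq))

module _ {d d' lo hi lo' hi'} (v : Valid n (rotate d lo hi)) (v' : Valid n (rotate d' lo' hi'))
         (agree : ∀ k → k < n → ⟦ rotate d lo hi ⟧ k ≡ ⟦ rotate d' lo' hi' ⟧ k) where

  rotate-same-lo : lo ≡ lo'
  rotate-same-lo with <-cmp lo lo'
  ... | tri< lo<lo' _ _ = contradiction (trans (agree lo (lo<n v)) (rotate-fixes-below v' lo<lo')) (rotate-moves-lo v)
  ... | tri≈ _ lo≡lo' _ = lo≡lo'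
  ... | tri> _ _ lo'<lo = contradiction (trans (sym (agree lo' (lo<n v'))) (rotate-fixes-below v lo'<lo)) (rotate-moves-lo v')

  rotate-same-hi : hi ≡ hi'
  rotate-same-hi with <-cmp hi hi'
  ... | tri< hi<hi' _ _ = contradiction (trans (sym (agree hi' (hi<n v'))) (rotate-fixes-above v hi<hi')) (rotate-moves-hi v')
  ... | tri≈ _ hi≡hi' _ = hi≡hi'
  ... | tri> _ _ hi'<hi = contradiction (trans (agree hi (hi<n v)) (rotate-fixes-above v' hi'<hi)) (rotate-moves-hi v)

rotate-same-dir : Valid n (rotate d lo hi) → Valid n (rotate d' lo hi) →
                  ⟦ rotate d lo hi ⟧ lo ≡ ⟦ rotate d' lo hi ⟧ lo → d ≡ d'
rotate-same-dir (left _ _) (left _ _) _ = refl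
rotate-same-dir (right _ _) (right _ _) _ = refl
rotate-same-dir {lo = lo} {hi = hi} (left lo<hi _) (right 1+lo<hi _) eq =
  contradiction (trans (sym (rotateˡ-inside ≤-refl lo<hi)) (trans eq (rotateʳ-first {lo = lo} {hi = hi}))) (<⇒≢ 1+lo<hi)
rotate-same-dir {lo = lo} {hi = hi} (right 1+lo<hi _) (left lo<hi _) eq =
  contradiction (trans (sym (rotateˡ-inside ≤-refl lo<hi)) (trans (sym eq) (rotateʳ-first {lo = lo} {hi = hi}))) (<⇒≢ 1+lo<hi)

shape-injective : Valid n c → Valid n c' → (∀ k → k < n → ⟦ c ⟧ k ≡ ⟦ c' ⟧ k) → c ≡ c'
shape-injective identity identity _ = refl
shape-injective identity v'@(left _ _) agree = contradiction (sym (agree _ (lo<n v'))) (rotate-moves-lo v')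
shape-injective identity v'@(right _ _) agree = contradiction (sym (agree _ (lo<n v'))) (rotate-moves-lo v')
shape-injective v@(left _ _) identity agree = contradiction (agree _ (lo<n v)) (rotate-moves-lo v)
shape-injective v@(right _ _) identity agree = contradiction (agree _ (lo<n v)) (rotate-moves-lo v)
shape-injective {c = rotate d lo hi} {c' = rotate d' _ _} v v' agree
  with rotate-same-lo v v' agree | rotate-same-hi v v' agree
... | refl | refl = cong (λ d → rotate d lo hi) (rotate-same-dir v v' (agree lo (lo<n v)))

-- Classification of pattern-avoiding functions

record GoodFunction (n : ℕ) (f : ℕ → ℕ) : Set where
  field
    injective  : ∀ {x y} → x < n → y < n → f x ≡ f y → x ≡ y
    bounded    : ∀ {x} → x < n → f x < n
    surjective : ∀ {y} → y < n → ∃ λ x → x < n × f x ≡ y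
    avoids321  : ∀ {a b c} → a < b → b < c → c < n → f c < f b → f b < f a → ⊥
    avoids2143 : ∀ {a b c d} → a < b → b < c → c < d → d < n → f b < f a → f a < f d → f d < f c → ⊥
    avoids3142 : ∀ {a b c d} → a < b → b < c → c < d → d < n → f b < f d → f d < f a → f a < f c → ⊥
    avoids2413 : ∀ {a b c d} → a < b → b < c → c < d → d < n → f c < f a → f a < f d → f d < f b → ⊥
    avoids3412 : ∀ {a b c d} → a < b → b < c → c < d → d < n → f c < f d → f d < f a → f a < f b → ⊥

module Classification {n f} (good : GoodFunction n f) where

  open GoodFunction good

  forced-value : ∀ {k t} → k < n →
    (∀ v → v < t → ∃ λ x → x < n × x ≢ k × f x ≡ v) →
    (∀ r → r < n → r ≢ k → f r ≡ t → t < f k → ⊥) →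
    f k ≡ t
  forced-value {k} {t} k<n taken nowhere with <-cmp (f k) t
  ... | tri< fk<t _ _ with taken (f k) fk<t
  ...   | x , x<n , x≢k , fx≡fk = contradiction (injective x<n k<n fx≡fk) x≢k
  forced-value k<n taken nowhere | tri≈ _ fk≡t _ = fk≡t
  forced-value {k} {t} k<n taken nowhere | tri> _ _ t<fk with surjective (<-trans t<fk (bounded k<n))
  ... | r , r<n , fr≡t = ⊥-elim (nowhere r r<n r≢k fr≡t t<fk)
    where
    r≢k : r ≢ k
    r≢k refl = <⇒≢ t<fk (sym fr≡t)

  <-via : ∀ {a b x y} → f a ≡ x → f b ≡ y → x < y → f a < f b
  <-via fa≡x fb≡y = subst₂ _<_ (sym fa≡x) (sym fb≡y)

  first-moved : ∀ m → (∀ k → k < m → f k ≡ k) ⊎ ∃ λ i → i < m × f i ≢ i × (∀ k → k < i → f k ≡ k)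
  first-moved zero = inj₁ λ _ ()
  first-moved (suc m) with first-moved m
  ... | inj₂ (i , i<m , moved , fixed) = inj₂ (i , m<n⇒m<1+n i<m , moved , fixed)
  ... | inj₁ fixed with f m ≟ m
  ...   | no moved = inj₂ (m , n<1+n m , moved , fixed)
  ...   | yes fm≡m = inj₁ λ k k<1+m → case m<1+n⇒m<n∨m≡n k<1+m of λ where
      (inj₁ k<m) → fixed k k<m
      (inj₂ refl) → fm≡m

  module FirstMoved {i} (i<n : i < n) (moved : f i ≢ i) (fixed : ∀ k → k < i → f k ≡ k) where

    i≤f : ∀ {k} → k < n → i ≤ k → i ≤ f k
    i≤f {k} k<n i≤k with f k <? i
    ... | yes fk<i = contradiction (injective (<-trans fk<i i<n) k<n (fixed (f k) fk<i)) (<⇒≢ (<-≤-trans fk<i i≤k))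
    ... | no fk≮i = ≮⇒≥ fk≮i

    i<f[i] : i < f i
    i<f[i] = ≤∧≢⇒< (i≤f i<n ≤-refl) (≢-sym moved)

    p : ℕ
    p = proj₁ (surjective i<n)

    p<n : p < n
    p<n = proj₁ (proj₂ (surjective i<n))

    f[p]≡i : f p ≡ i
    f[p]≡i = proj₂ (proj₂ (surjective i<n))

    i<p : i < p
    i<p with <-cmp p i
    ... | tri< p<i _ _ = contradiction (trans (sym (fixed p p<i)) f[p]≡i) (<⇒≢ p<i)
    ... | tri≈ _ p≡i _ = contradiction (subst (λ x → f x ≡ i) p≡i f[p]≡i) moved
    ... | tri> _ _ i<p = i<p

    module Left (f[i]≡1+i : f i ≡ suc i) where

      shifted : ∀ k → i ≤ k → k < p → f k ≡ suc k
      shifted = <-rec _ step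
        where
        step : ∀ k → (∀ {m} → m < k → i ≤ m → m < p → f m ≡ suc m) → i ≤ k → k < p → f k ≡ suc k
        step k ih i≤k k<p with m≤n⇒m<n∨m≡n i≤k
        ... | inj₂ refl = f[i]≡1+i
        ... | inj₁ i<k = forced-value k<n taken nowhere
          where
          k<n : k < n
          k<n = <-trans k<p p<n
          taken : ∀ v → v < suc k → ∃ λ x → x < n × x ≢ k × f x ≡ v
          taken v v<1+k with <-cmp v i
          ... | tri< v<i _ _ = v , <-trans v<i i<n , <⇒≢ (<-trans v<i i<k) , fixed v v<i
          ... | tri≈ _ refl _ = p , p<n , >⇒≢ k<p , f[p]≡i
          ... | tri> _ _ (s≤s {n = u} i≤u) = u , <-trans u<k k<n , <⇒≢ u<k , ih u<k i≤u (<-trans u<k k<p)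
            where u<k = ≤-pred v<1+k
          nowhere : ∀ r → r < n → r ≢ k → f r ≡ suc k → suc k < f k → ⊥
          nowhere r r<n r≢k f[r]≡1+k 1+k<f[k] with <-cmp r k
          ... | tri≈ _ r≡k _ = r≢k r≡k
          ... | tri< r<k _ _ with r <? i
          ...   | yes r<i = <⇒≢ (<-trans r<k (n<1+n k)) (trans (sym (fixed r r<i)) f[r]≡1+k)
          ...   | no r≮i = <⇒≢ r<k (suc-injective (trans (sym (ih r<k (≮⇒≥ r≮i) (<-trans r<k k<p))) f[r]≡1+k))
          nowhere r r<n r≢k f[r]≡1+k 1+k<f[k] | tri> _ _ k<r with <-cmp r p
          ... | tri< r<p _ _ = avoids321 k<r r<p p<n
                (<-via f[p]≡i f[r]≡1+k (<-trans i<k (n<1+n k))) (<-via f[r]≡1+k refl 1+k<f[k])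
          ... | tri≈ _ r≡p _ = <⇒≢ (<-trans i<k (n<1+n k)) (trans (sym f[p]≡i) (trans (cong f (sym r≡p)) f[r]≡1+k))
          ... | tri> _ _ p<r = avoids2413 i<k k<p p<r r<n
                (<-via f[p]≡i f[i]≡1+i (n<1+n i)) (<-via f[i]≡1+i f[r]≡1+k (s≤s i<k)) (<-via f[r]≡1+k refl 1+k<f[k])

      fixed-after : ∀ k → p < k → k < n → f k ≡ k
      fixed-after = <-rec _ step
        where
        step : ∀ k → (∀ {m} → m < k → p < m → m < n → f m ≡ m) → p < k → k < n → f k ≡ k
        step k ih p<k k<n = forced-value k<n taken nowhere
          where
          taken : ∀ v → v < k → ∃ λ x → x < n × x ≢ k × f x ≡ v
          taken v v<k with <-cmp v i
          ... | tri< v<i _ _ = v , <-trans v<i i<n , <⇒≢ v<k , fixed v v<i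
          ... | tri≈ _ refl _ = p , p<n , <⇒≢ p<k , f[p]≡i
          ... | tri> _ _ (s≤s {n = u} i≤u) with u <? p
          ...   | yes u<p = u , <-trans u<p p<n , <⇒≢ (<-trans u<p p<k) , shifted u i≤u u<p
          ...   | no u≮p = suc u , <-trans v<k k<n , <⇒≢ v<k , ih v<k (s≤s (≮⇒≥ u≮p)) (<-trans v<k k<n)
          nowhere : ∀ r → r < n → r ≢ k → f r ≡ k → k < f k → ⊥
          nowhere r r<n r≢k f[r]≡k k<f[k] with <-cmp r k
          ... | tri≈ _ r≡k _ = r≢k r≡k
          ... | tri> _ _ k<r = avoids2143 i<p p<k k<r r<n
                (<-via f[p]≡i f[i]≡1+i (n<1+n i)) (<-via f[i]≡1+i f[r]≡k (≤-<-trans i<p p<k)) (<-via f[r]≡k refl k<f[k])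
          ... | tri< r<k _ _ with <-cmp r p
          ...   | tri> _ _ p<r = <⇒≢ r<k (trans (sym (ih r<k p<r r<n)) f[r]≡k)
          ...   | tri≈ _ r≡p _ = <⇒≢ (<-trans i<p p<k) (trans (sym f[p]≡i) (trans (cong f (sym r≡p)) f[r]≡k))
          ...   | tri< r<p _ _ with r <? i
          ...     | yes r<i = <⇒≢ r<k (trans (sym (fixed r r<i)) f[r]≡k)
          ...     | no r≮i = <⇒≢ (≤-<-trans r<p p<k) (trans (sym (shifted r (≮⇒≥ r≮i) r<p)) f[r]≡k)

      agrees : ∀ k → k < n → f k ≡ ⟦ rotate left i p ⟧ k
      agrees k k<n with rotateˡ i p k | rotateˡ-view i p k
      ... | _ | below k<i = fixed k k<i
      ... | _ | inside i≤k k<p = shifted k i≤k k<p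
      ... | _ | last = f[p]≡i
      ... | _ | above p<k = fixed-after k p<k k<n

    module Right (1+i<f[i] : suc i < f i) (f[1+i]≡i : f (suc i) ≡ i) where

      shifted : ∀ m → i ≤ m → m < f i → f (suc m) ≡ m
      shifted = <-rec _ step
        where
        step : ∀ m → (∀ {u} → u < m → i ≤ u → u < f i → f (suc u) ≡ u) → i ≤ m → m < f i → f (suc m) ≡ m
        step m ih i≤m m<f[i] with m≤n⇒m<n∨m≡n i≤m
        ... | inj₂ refl = f[1+i]≡i
        ... | inj₁ i<m = forced-value 1+m<n taken nowhere
          where
          1+m<n : suc m < n
          1+m<n = ≤-<-trans m<f[i] (bounded i<n)
          taken : ∀ v → v < m → ∃ λ x → x < n × x ≢ suc m × f x ≡ v
          taken v v<m with v <? i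
          ... | yes v<i = v , <-trans v<i i<n , <⇒≢ (<-trans v<m (n<1+n m)) , fixed v v<i
          ... | no v≮i = suc v , <-trans (s≤s v<m) 1+m<n , <⇒≢ (s≤s v<m) ,
                         ih v<m (≮⇒≥ v≮i) (<-trans v<m m<f[i])
          nowhere : ∀ r → r < n → r ≢ suc m → f r ≡ m → m < f (suc m) → ⊥
          nowhere r r<n r≢1+m f[r]≡m m<f[1+m] with <-cmp r (suc m)
          ... | tri≈ _ r≡1+m _ = r≢1+m r≡1+m
          ... | tri< r<1+m _ _ with <-cmp r i
          ...   | tri< r<i _ _ = <⇒≢ (<-trans r<i i<m) (trans (sym (fixed r r<i)) f[r]≡m)
          ...   | tri≈ _ refl _ = <⇒≢ m<f[i] (sym f[r]≡m)
          ...   | tri> _ _ (s≤s i≤u) = <⇒≢ u<m (trans (sym (ih u<m i≤u (<-trans u<m m<f[i]))) f[r]≡m)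
            where u<m = ≤-pred r<1+m
          nowhere r r<n r≢1+m f[r]≡m m<f[1+m] | tri> _ _ 1+m<r with <-cmp (f (suc m)) (f i)
          ... | tri< f[1+m]<f[i] _ _ =
                avoids321 (<-trans (n<1+n i) (s≤s i<m)) 1+m<r r<n (<-via f[r]≡m refl m<f[1+m]) f[1+m]<f[i]
          ... | tri≈ _ f[1+m]≡f[i] _ = <⇒≢ (<-trans (n<1+n i) (s≤s i<m)) (sym (injective 1+m<n i<n f[1+m]≡f[i]))
          ... | tri> _ _ f[i]<f[1+m] = avoids3142 (n<1+n i) (s≤s i<m) 1+m<r r<n
                (<-via f[1+i]≡i f[r]≡m i<m) (<-via f[r]≡m refl m<f[i]) f[i]<f[1+m]

      fixed-after : ∀ k → f i < k → k < n → f k ≡ k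
      fixed-after = <-rec _ step
        where
        step : ∀ k → (∀ {m} → m < k → f i < m → m < n → f m ≡ m) → f i < k → k < n → f k ≡ k
        step k ih f[i]<k k<n = forced-value k<n taken nowhere
          where
          taken : ∀ v → v < k → ∃ λ x → x < n × x ≢ k × f x ≡ v
          taken v v<k with <-cmp v (f i)
          ... | tri≈ _ refl _ = i , i<n , <⇒≢ (<-trans i<f[i] f[i]<k) , refl
          ... | tri> _ _ f[i]<v = v , <-trans v<k k<n , <⇒≢ v<k , ih v<k f[i]<v (<-trans v<k k<n)
          ... | tri< v<f[i] _ _ with v <? i
          ...   | yes v<i = v , <-trans v<i i<n , <⇒≢ v<k , fixed v v<i
          ...   | no v≮i = suc v , ≤-<-trans v<f[i] (bounded i<n) , <⇒≢ (≤-<-trans v<f[i] f[i]<k) ,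
                           shifted v (≮⇒≥ v≮i) v<f[i]
          nowhere : ∀ r → r < n → r ≢ k → f r ≡ k → k < f k → ⊥
          nowhere r r<n r≢k f[r]≡k k<f[k] with <-cmp r k
          ... | tri≈ _ r≡k _ = r≢k r≡k
          ... | tri> _ _ k<r = avoids2143 (n<1+n i) (<-trans 1+i<f[i] f[i]<k) k<r r<n
                (<-via f[1+i]≡i refl i<f[i]) (<-via refl f[r]≡k f[i]<k) (<-via f[r]≡k refl k<f[k])
          ... | tri< r<k _ _ with <-cmp r i
          ...   | tri< r<i _ _ = <⇒≢ r<k (trans (sym (fixed r r<i)) f[r]≡k)
          ...   | tri≈ _ refl _ = <⇒≢ f[i]<k f[r]≡k
          ...   | tri> _ _ (s≤s {n = u} i≤u) with u <? f i
          ...     | yes u<f[i] = <⇒≢ (<-trans u<f[i] f[i]<k) (trans (sym (shifted u i≤u u<f[i])) f[r]≡k)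
          ...     | no u≮f[i] = <⇒≢ r<k (trans (sym (ih r<k (s≤s (≮⇒≥ u≮f[i])) r<n)) f[r]≡k)

      agrees : ∀ k → k < n → f k ≡ ⟦ rotate right i (f i) ⟧ k
      agrees k k<n with rotateʳ i (f i) k | rotateʳ-view i (f i) k
      ... | _ | below k<i = fixed k k<i
      ... | _ | first = refl
      ... | _ | inside i≤m m<f[i] = shifted _ i≤m m<f[i]
      ... | _ | above f[i]<k = fixed-after k f[i]<k k<n

    neither : suc i < f i → suc i < p → ⊥
    neither 1+i<f[i] 1+i<p = impossible
      where
      1+i<n : suc i < n
      1+i<n = <-trans 1+i<p p<n
      i<f[1+i] : i < f (suc i)
      i<f[1+i] = ≤∧≢⇒< (i≤f 1+i<n (n≤1+n i)) λ i≡f[1+i] →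
        <⇒≢ 1+i<p (injective 1+i<n p<n (trans (sym i≡f[1+i]) (sym f[p]≡i)))
      impossible : ⊥
      impossible with <-cmp (f (suc i)) (f i)
      ... | tri< f[1+i]<f[i] _ _ = avoids321 (n<1+n i) 1+i<p p<n (<-via f[p]≡i refl i<f[1+i]) f[1+i]<f[i]
      ... | tri≈ _ f[1+i]≡f[i] _ = 1+n≢n (injective 1+i<n i<n f[1+i]≡f[i])
      ... | tri> _ _ f[i]<f[1+i] with surjective 1+i<n
      ...   | q , q<n , f[q]≡1+i with <-cmp q (suc i)
      ...     | tri≈ _ refl _ = <⇒≢ (<-trans 1+i<f[i] f[i]<f[1+i]) (sym f[q]≡1+i)
      ...     | tri< q<1+i _ _ = case m<1+n⇒m<n∨m≡n q<1+i of λ where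
                  (inj₁ q<i) → <⇒≢ (<-trans q<i (n<1+n i)) (trans (sym (fixed q q<i)) f[q]≡1+i)
                  (inj₂ refl) → <⇒≢ 1+i<f[i] (sym f[q]≡1+i)
      ...     | tri> _ _ 1+i<q with <-cmp q p
      ...       | tri< q<p _ _ = avoids321 1+i<q q<p p<n (<-via f[p]≡i f[q]≡1+i (n<1+n i))
                    (<-via f[q]≡1+i refl (<-trans 1+i<f[i] f[i]<f[1+i]))
      ...       | tri≈ _ q≡p _ = 1+n≢n (trans (sym f[q]≡1+i) (trans (cong f q≡p) f[p]≡i))
      ...       | tri> _ _ p<q = avoids3412 (n<1+n i) 1+i<p p<q q<n
                    (<-via f[p]≡i f[q]≡1+i (n<1+n i)) (<-via f[q]≡1+i refl 1+i<f[i]) f[i]<f[1+i]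

    classify : ∃ λ c → Valid n c × (∀ k → k < n → f k ≡ ⟦ c ⟧ k)
    classify with f i ≟ suc i | p ≟ suc i
    ... | yes f[i]≡1+i | _ = rotate left i p , left i<p p<n , Left.agrees f[i]≡1+i
    ... | no f[i]≢1+i | yes p≡1+i = rotate right i (f i) , right 1+i<f[i] (bounded i<n) ,
          Right.agrees 1+i<f[i] (subst (λ x → f x ≡ i) p≡1+i f[p]≡i)
      where 1+i<f[i] = ≤∧≢⇒< i<f[i] (≢-sym f[i]≢1+i)
    ... | no f[i]≢1+i | no p≢1+i = ⊥-elim (neither (≤∧≢⇒< i<f[i] (≢-sym f[i]≢1+i)) (≤∧≢⇒< i<p (≢-sym p≢1+i)))

  classification : ∃ λ c → Valid n c × (∀ k → k < n → f k ≡ ⟦ c ⟧ k)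
  classification with first-moved n
  ... | inj₁ fixed = identity , identity , fixed
  ... | inj₂ (i , i<n , moved , fixed) = FirstMoved.classify i<n moved fixed

-- One-line notation

-- 0 is a junk value for positions k ≥ n.
valueAt : Vec (Fin n) n → ℕ → ℕ
valueAt {n} w k with k <? n
... | yes k<n = toℕ (lookup w (fromℕ< k<n))
... | no _ = 0

valueAt-fromℕ< : ∀ (w : Vec (Fin n) n) (k<n : k < n) → valueAt w k ≡ toℕ (lookup w (fromℕ< k<n))
valueAt-fromℕ< {n} {k} w k<n with k <? n
... | yes _ = refl
... | no k≮n = contradiction k<n k≮n

Represents : Vec (Fin n) n → (ℕ → ℕ) → Set
Represents w f = ∀ i → toℕ (lookup w i) ≡ f (toℕ i)

valueAt-represents : ∀ (w : Vec (Fin n) n) → Represents w (valueAt w)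
valueAt-represents w i = begin
  toℕ (lookup w i)                         ≡⟨ cong (λ j → toℕ (lookup w j)) (sym (fromℕ<-toℕ i (toℕ<n i))) ⟩
  toℕ (lookup w (fromℕ< (toℕ<n i)))        ≡⟨ sym (valueAt-fromℕ< w (toℕ<n i)) ⟩
  valueAt w (toℕ i)                        ∎
  where open ≡-Reasoning

represents-≡ : ∀ {w w' : Vec (Fin n) n} {f g} → Represents w f → Represents w' g →
               (∀ k → k < n → f k ≡ g k) → w ≡ w'
represents-≡ {w = w} {w'} rep rep' agree = begin
  w                     ≡⟨ sym (tabulate∘lookup w) ⟩
  tabulate (lookup w)   ≡⟨ tabulate-cong (λ i → toℕ-injective
                             (trans (rep i) (trans (agree (toℕ i) (toℕ<n i)) (sym (rep' i))))) ⟩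
  tabulate (lookup w')  ≡⟨ tabulate∘lookup w' ⟩
  w'                    ∎
  where open ≡-Reasoning

represents-isPerm : ∀ {w : Vec (Fin n) n} {f} → Represents w f → (∀ {x y} → f x ≡ f y → x ≡ y) → IsPerm w
represents-isPerm rep f-injective i j eq =
  toℕ-injective (f-injective (trans (sym (rep i)) (trans (cong toℕ eq) (rep j))))

fromℕ-or : Fin n → ℕ → Fin n
fromℕ-or {n} default k with k <? n
... | yes k<n = fromℕ< k<n
... | no _ = default

toℕ-fromℕ-or : (default : Fin n) → k < n → toℕ (fromℕ-or default k) ≡ k
toℕ-fromℕ-or {n} {k} _ k<n with k <? n
... | yes _ = toℕ-fromℕ< k<n
... | no k≮n = contradiction k<n k≮n

permutation : ∀ n → Shape → Vec (Fin n) n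
permutation n c = tabulate (λ i → fromℕ-or i (⟦ c ⟧ (toℕ i)))

permutation-represents : ∀ {c} → Valid n c → Represents (permutation n c) ⟦ c ⟧
permutation-represents {c = c} v i =
  trans (cong toℕ (lookup∘tabulate _ i)) (toℕ-fromℕ-or i (⟦⟧-< v (toℕ<n i)))

lookup-<⇔ : ∀ {k} {xs : Vec ℕ k} → Linked _<_ xs → ∀ i j → lookup xs i < lookup xs j ⇔ i Fin.< j
lookup-<⇔ {xs = xs} increasing i j = mk⇔ reflect (Linked-lookup⁺ <-trans increasing)
  where
  reflect : lookup xs i < lookup xs j → i Fin.< j
  reflect lt with <-cmp (toℕ i) (toℕ j)
  ... | tri< i<j _ _ = i<j
  ... | tri≈ _ i≡j _ = contradiction (cong (lookup xs) (toℕ-injective i≡j)) (<⇒≢ lt)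
  ... | tri> _ _ j<i = contradiction (Linked-lookup⁺ <-trans increasing j<i) (<⇒≯ lt)

-- The occurrence has increasing positions, and the value at the j-th of them is the
-- (lookup v j)-th entry of the increasing vector values.
contains : ∀ {k} (w : Vec (Fin n) n) (v : Vec (Fin k) k) (positions values : Vec ℕ k) →
           Linked _<_ positions → VecAll.All (_< n) positions → Linked _<_ values →
           Vec.map (valueAt w) positions ≡ Vec.map (lookup values) v → Contains w v
contains w v positions values positions↑ positions<n values↑ occurrence = ι , ι-increasing , order
  where
  ι : _ → Fin _
  ι j = fromℕ< (VecAll.lookup⁺ positions<n j)
  toℕ-ι : ∀ j → toℕ (ι j) ≡ lookup positions j
  toℕ-ι j = toℕ-fromℕ< (VecAll.lookup⁺ positions<n j)
  ι-increasing : ∀ j m → j Fin.< m → ι j Fin.< ι m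
  ι-increasing j m j<m = subst₂ _<_ (sym (toℕ-ι j)) (sym (toℕ-ι m)) (Linked-lookup⁺ <-trans positions↑ j<m)
  value : ∀ j → toℕ (lookup w (ι j)) ≡ lookup values (lookup v j)
  value j = begin
    toℕ (lookup w (ι j))                 ≡⟨ valueAt-represents w (ι j) ⟩
    valueAt w (toℕ (ι j))                ≡⟨ cong (valueAt w) (toℕ-ι j) ⟩
    valueAt w (lookup positions j)       ≡⟨ sym (lookup-map j (valueAt w) positions) ⟩
    lookup (Vec.map (valueAt w) positions) j ≡⟨ cong (λ ys → lookup ys j) occurrence ⟩
    lookup (Vec.map (lookup values) v) j     ≡⟨ lookup-map j (lookup values) v ⟩
    lookup values (lookup v j)           ∎
    where open ≡-Reasoning
  order : ∀ j m → lookup w (ι j) Fin.< lookup w (ι m) ⇔ lookup v j Fin.< lookup v m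
  order j m = mk⇔
    (λ lt → Equivalence.to (lookup-<⇔ values↑ _ _) (subst₂ _<_ (value j) (value m) lt))
    (λ lt → subst₂ _<_ (sym (value j)) (sym (value m)) (Equivalence.from (lookup-<⇔ values↑ _ _) lt))

injective⇒surjective : ∀ (g : Fin n → Fin n) → (∀ {i j} → g i ≡ g j → i ≡ j) → ∀ j → ∃ λ i → g i ≡ j
injective⇒surjective {suc n} g g-injective j with any? (λ i → g i ≟ᶠ j)
... | yes found = found
... | no missed = contradiction (injective⇒≤ punchOut-injective′) (n≮n n)
  where
  missing : ∀ i → j ≢ g i
  missing i j≡gi = missed (i , sym j≡gi)
  punchOut-injective′ : ∀ {i i'} → punchOut (missing i) ≡ punchOut (missing i') → i ≡ i'
  punchOut-injective′ {i} {i'} eq = g-injective (punchOut-injective (missing i) (missing i') eq)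

goodFunction : ∀ {w : Vec (Fin n) n} → Good w → GoodFunction n (valueAt w)
goodFunction {n} {w} (isPerm , ¬321 , ¬2143 , ¬3142 , ¬2413 , ¬3412) = record
  { injective  = injective
  ; bounded    = λ x<n → subst (_< n) (sym (valueAt-fromℕ< w x<n)) (toℕ<n _)
  ; surjective = surjective
  ; avoids321  = λ a<b b<c c<n l₁ l₂ → ¬321 (occurrence₃ p321 a<b b<c c<n (l₁ ∷ l₂ ∷ [-]) refl)
  ; avoids2143 = λ a<b b<c c<d d<n l₁ l₂ l₃ → ¬2143 (occurrence₄ p2143 a<b b<c c<d d<n (l₁ ∷ l₂ ∷ l₃ ∷ [-]) refl)
  ; avoids3142 = λ a<b b<c c<d d<n l₁ l₂ l₃ → ¬3142 (occurrence₄ p3142 a<b b<c c<d d<n (l₁ ∷ l₂ ∷ l₃ ∷ [-]) refl)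
  ; avoids2413 = λ a<b b<c c<d d<n l₁ l₂ l₃ → ¬2413 (occurrence₄ p2413 a<b b<c c<d d<n (l₁ ∷ l₂ ∷ l₃ ∷ [-]) refl)
  ; avoids3412 = λ a<b b<c c<d d<n l₁ l₂ l₃ → ¬3412 (occurrence₄ p3412 a<b b<c c<d d<n (l₁ ∷ l₂ ∷ l₃ ∷ [-]) refl)
  }
  where
  injective : x < n → y < n → valueAt w x ≡ valueAt w y → x ≡ y
  injective {x} {y} x<n y<n eq = begin
    x                     ≡⟨ sym (toℕ-fromℕ< x<n) ⟩
    toℕ (fromℕ< x<n)      ≡⟨ cong toℕ (isPerm _ _ (toℕ-injective (begin
      toℕ (lookup w (fromℕ< x<n)) ≡⟨ sym (valueAt-fromℕ< w x<n) ⟩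
      valueAt w x                 ≡⟨ eq ⟩
      valueAt w y                 ≡⟨ valueAt-fromℕ< w y<n ⟩
      toℕ (lookup w (fromℕ< y<n)) ∎))) ⟩
    toℕ (fromℕ< y<n)      ≡⟨ toℕ-fromℕ< y<n ⟩
    y                     ∎
    where open ≡-Reasoning
  surjective : y < n → ∃ λ x → x < n × valueAt w x ≡ y
  surjective {y} y<n with injective⇒surjective (lookup w) (isPerm _ _) (fromℕ< y<n)
  ... | i , wi≡y = toℕ i , toℕ<n i ,
    trans (sym (valueAt-represents w i)) (trans (cong toℕ wi≡y) (toℕ-fromℕ< y<n))
  occurrence₃ : ∀ v {a b c} {values : Vec ℕ 3} → a < b → b < c → c < n → Linked _<_ values →
                Vec.map (valueAt w) (a ∷ b ∷ c ∷ []) ≡ Vec.map (lookup values) v → Contains w v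
  occurrence₃ v a<b b<c c<n = contains w v _ _ (a<b ∷ b<c ∷ [-])
    (<-trans a<b (<-trans b<c c<n) ∷ <-trans b<c c<n ∷ c<n ∷ [])
  occurrence₄ : ∀ v {a b c d} {values : Vec ℕ 4} → a < b → b < c → c < d → d < n → Linked _<_ values →
                Vec.map (valueAt w) (a ∷ b ∷ c ∷ d ∷ []) ≡ Vec.map (lookup values) v → Contains w v
  occurrence₄ v a<b b<c c<d d<n = contains w v _ _ (a<b ∷ b<c ∷ c<d ∷ [-])
    (<-trans a<b (<-trans b<c (<-trans c<d d<n)) ∷ <-trans b<c (<-trans c<d d<n) ∷ <-trans c<d d<n ∷ d<n ∷ [])

module _ {w : Vec (Fin n) n} {f e} (rep : Represents w f) (through : InversionsThrough f e) where

  private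
    inversion-through : ∀ {k} (v : Vec (Fin k) k) → ((ι , _) : Contains w v) → ∀ i j → i Fin.< j →
                        lookup v j Fin.< lookup v i → toℕ (ι i) ≡ e ⊎ toℕ (ι j) ≡ e
    inversion-through v (ι , ι-increasing , order) i j i<j vj<vi =
      through (ι-increasing i j i<j) (subst₂ _<_ (rep (ι j)) (rep (ι i)) (Equivalence.from (order j i) vj<vi))

    ι-distinct : ∀ {k} (v : Vec (Fin k) k) → ((ι , _) : Contains w v) → ∀ i j → i ≢ j → toℕ (ι i) ≢ toℕ (ι j)
    ι-distinct v (ι , ι-increasing , _) i j i≢j eq with <-cmp (toℕ i) (toℕ j)
    ... | tri< i<j _ _ = <⇒≢ (ι-increasing i j i<j) eq
    ... | tri≈ _ i≡j _ = i≢j (toℕ-injective i≡j)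
    ... | tri> _ _ j<i = <⇒≢ (ι-increasing j i j<i) (sym eq)

  avoids-disjoint-inversions : ∀ {k} (v : Vec (Fin k) k) (i j i' j' : Fin k) →
    i Fin.< j → lookup v j Fin.< lookup v i → i' Fin.< j' → lookup v j' Fin.< lookup v i' →
    i ≢ i' → i ≢ j' → j ≢ i' → j ≢ j' → Avoids w v
  avoids-disjoint-inversions v i j i' j' i<j vj<vi i'<j' vj'<vi' i≢i' i≢j' j≢i' j≢j' occ
    with inversion-through v occ i j i<j vj<vi | inversion-through v occ i' j' i'<j' vj'<vi'
  ... | inj₁ ιi≡e | inj₁ ιi'≡e = ι-distinct v occ i i' i≢i' (trans ιi≡e (sym ιi'≡e))
  ... | inj₁ ιi≡e | inj₂ ιj'≡e = ι-distinct v occ i j' i≢j' (trans ιi≡e (sym ιj'≡e))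
  ... | inj₂ ιj≡e | inj₁ ιi'≡e = ι-distinct v occ j i' j≢i' (trans ιj≡e (sym ιi'≡e))
  ... | inj₂ ιj≡e | inj₂ ιj'≡e = ι-distinct v occ j j' j≢j' (trans ιj≡e (sym ιj'≡e))

  private
    0F 1F 2F : ∀ {k} → Fin (3 + k)
    3F : ∀ {k} → Fin (4 + k)
    0F = fzero
    1F = fsuc fzero
    2F = fsuc (fsuc fzero)
    3F = fsuc (fsuc (fsuc fzero))

  avoids-321 : Avoids w p321
  avoids-321 occ with inversion-through p321 occ 0F 1F z<s (s<s z<s)
  ... | inj₁ ι₀≡e with inversion-through p321 occ 1F 2F (s<s z<s) z<s
  ...   | inj₁ ι₁≡e = ι-distinct p321 occ 0F 1F (λ ()) (trans ι₀≡e (sym ι₁≡e))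
  ...   | inj₂ ι₂≡e = ι-distinct p321 occ 0F 2F (λ ()) (trans ι₀≡e (sym ι₂≡e))
  avoids-321 occ | inj₂ ι₁≡e with inversion-through p321 occ 0F 2F z<s z<s
  ...   | inj₁ ι₀≡e = ι-distinct p321 occ 1F 0F (λ ()) (trans ι₁≡e (sym ι₀≡e))
  ...   | inj₂ ι₂≡e = ι-distinct p321 occ 1F 2F (λ ()) (trans ι₁≡e (sym ι₂≡e))

  avoidsAll : AvoidsAll w
  avoidsAll = avoids-321
    , avoids-disjoint-inversions p2143 0F 1F 2F 3F z<s z<s (s<s (s<s z<s)) (s<s (s<s z<s)) (λ ()) (λ ()) (λ ()) (λ ())
    , avoids-disjoint-inversions p3142 0F 1F 2F 3F z<s z<s (s<s (s<s z<s)) (s<s z<s) (λ ()) (λ ()) (λ ()) (λ ())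
    , avoids-disjoint-inversions p2413 0F 2F 1F 3F z<s z<s (s<s z<s) (s<s (s<s z<s)) (λ ()) (λ ()) (λ ()) (λ ())
    , avoids-disjoint-inversions p3412 0F 2F 1F 3F z<s z<s (s<s z<s) (s<s z<s) (λ ()) (λ ()) (λ ()) (λ ())

-- Counting

leftsEndingAt rightsEndingAt endingAt : ℕ → List Shape
leftsEndingAt hi = map (λ lo → rotate left lo hi) (upTo hi)
rightsEndingAt hi = map (λ lo → rotate right lo hi) (upTo (hi ∸ 1))
endingAt hi = leftsEndingAt hi ++ rightsEndingAt hi

rotations : ℕ → List Shape
rotations zero = []
rotations (suc n) = rotations n ++ endingAt n

shapes : ℕ → List Shape
shapes n = identity ∷ rotations n

valid-suc : Valid n c → Valid (suc n) c
valid-suc identity = identity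
valid-suc (left lo<hi hi<n) = left lo<hi (m<n⇒m<1+n hi<n)
valid-suc (right 1+lo<hi hi<n) = right 1+lo<hi (m<n⇒m<1+n hi<n)

∈-endingAt⁻ : c ∈ endingAt hi → Valid (suc hi) c × ¬ Valid hi c
∈-endingAt⁻ {hi = hi} c∈ with ∈-++⁻ (leftsEndingAt hi) c∈
... | inj₁ c∈ˡ with ∈-map⁻ (λ lo → rotate left lo hi) c∈ˡ
...   | lo , lo∈ , refl = left (∈-upTo⁻ lo∈) (n<1+n hi) , λ v → n≮n hi (hi<n v)
∈-endingAt⁻ {hi = suc hi} c∈ | inj₂ c∈ʳ with ∈-map⁻ (λ lo → rotate right lo (suc hi)) c∈ʳ
...   | lo , lo∈ , refl = right (s≤s (∈-upTo⁻ lo∈)) (n<1+n (suc hi)) , λ v → n≮n (suc hi) (hi<n v)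

∈-rotations⁻ : c ∈ rotations n → Valid n c
∈-rotations⁻ {n = suc n} c∈ with ∈-++⁻ (rotations n) c∈
... | inj₁ c∈r = valid-suc (∈-rotations⁻ c∈r)
... | inj₂ c∈e = proj₁ (∈-endingAt⁻ c∈e)

∈-rotations⁺ : Valid n (rotate d lo hi) → rotate d lo hi ∈ rotations n
∈-rotations⁺ {n = zero} v = contradiction (hi<n v) λ ()
∈-rotations⁺ {n = suc n} v with m<1+n⇒m<n∨m≡n (hi<n v)
∈-rotations⁺ {n = suc n} (left lo<hi _) | inj₁ hi<n = ∈-++⁺ˡ (∈-rotations⁺ (left lo<hi hi<n))
∈-rotations⁺ {n = suc n} (right 1+lo<hi _) | inj₁ hi<n = ∈-++⁺ˡ (∈-rotations⁺ (right 1+lo<hi hi<n))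
∈-rotations⁺ {n = suc n} (left lo<n _) | inj₂ refl =
  ∈-++⁺ʳ (rotations n) (∈-++⁺ˡ (∈-map⁺ (λ lo → rotate left lo n) (∈-upTo⁺ lo<n)))
∈-rotations⁺ {n = suc n} (right (s≤s lo<n-1) _) | inj₂ refl =
  ∈-++⁺ʳ (rotations n) (∈-++⁺ʳ (leftsEndingAt n) (∈-map⁺ (λ lo → rotate right lo n) (∈-upTo⁺ lo<n-1)))

identity∉rotations : identity ∉ rotations n
identity∉rotations {suc n} id∈ with ∈-++⁻ (rotations n) id∈
... | inj₁ id∈r = identity∉rotations {n} id∈r
... | inj₂ id∈e with ∈-++⁻ (leftsEndingAt n) id∈e
...   | inj₁ id∈ˡ with () ← proj₂ (proj₂ (∈-map⁻ (λ lo → rotate left lo n) id∈ˡ))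
...   | inj₂ id∈ʳ with () ← proj₂ (proj₂ (∈-map⁻ (λ lo → rotate right lo n) id∈ʳ))

endingAt-unique : ∀ hi → Unique (endingAt hi)
endingAt-unique hi = Unique.++⁺ (Unique.map⁺ (λ { refl → refl }) (Unique.upTo⁺ hi))
                                (Unique.map⁺ (λ { refl → refl }) (Unique.upTo⁺ (hi ∸ 1)))
                                λ (c∈ˡ , c∈ʳ) → case ∈-map⁻ (λ lo → rotate left lo hi) c∈ˡ ,
                                                     ∈-map⁻ (λ lo → rotate right lo hi) c∈ʳ of λ where
                                  ((_ , _ , refl) , (_ , _ , ()))

rotations-unique : ∀ n → Unique (rotations n)
rotations-unique zero = []
rotations-unique (suc n) = Unique.++⁺ (rotations-unique n) (endingAt-unique n)
  λ (c∈r , c∈e) → proj₂ (∈-endingAt⁻ c∈e) (∈-rotations⁻ {n = n} c∈r)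

shapes-unique : ∀ n → Unique (shapes n)
shapes-unique n = All.¬Any⇒All¬ (rotations n) (identity∉rotations {n}) ∷ rotations-unique n

square-suc : ∀ m → m * m + (suc m + m) ≡ suc m * suc m
square-suc = solve-∀

length-rotations : ∀ m → length (rotations (suc m)) ≡ m * m
length-rotations zero = refl
length-rotations (suc m) = begin
  length (rotations (suc m) ++ endingAt (suc m))                 ≡⟨ length-++ (rotations (suc m)) ⟩
  length (rotations (suc m)) + length (endingAt (suc m))         ≡⟨ cong₂ _+_ (length-rotations m) length-endingAt ⟩
  m * m + (suc m + m)                                            ≡⟨ square-suc m ⟩
  suc m * suc m                                                  ∎
  where
  open ≡-Reasoning
  length-endingAt : length (endingAt (suc m)) ≡ suc m + m
  length-endingAt = trans (length-++ (leftsEndingAt (suc m)))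
    (cong₂ _+_ (trans (length-map _ (upTo (suc m))) (length-upTo (suc m))) (trans (length-map _ (upTo m)) (length-upTo m)))

unique-map⁺ : ∀ {A B : Set} {P : A → Set} {f : A → B} {xs} →
              (∀ {x y} → P x → P y → f x ≡ f y → x ≡ y) → All P xs → Unique xs → Unique (map f xs)
unique-map⁺ f-injective [] [] = []
unique-map⁺ f-injective (px ∷ pxs) (x∉xs ∷ xs-unique) =
  All.map⁺ (All.zipWith (λ (x≢y , py) fx≡fy → x≢y (f-injective px py fx≡fy)) (x∉xs , pxs))
  ∷ unique-map⁺ f-injective pxs xs-unique

∈-─⁺ : ∀ {A : Set} {x z : A} {ys} (x∈ys : x ∈ ys) → z ∈ ys → z ≢ x → z ∈ ys ─ x∈ys
∈-─⁺ (here refl) (here refl) z≢x = contradiction refl z≢x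
∈-─⁺ (here _) (there z∈ys) _ = z∈ys
∈-─⁺ (there _) (here refl) _ = here refl
∈-─⁺ (there x∈ys) (there z∈ys) z≢x = there (∈-─⁺ x∈ys z∈ys z≢x)

unique-⊆⇒length-≤ : ∀ {A : Set} {xs ys : List A} → Unique xs → (∀ {z} → z ∈ xs → z ∈ ys) →
                    length xs ≤ length ys
unique-⊆⇒length-≤ {xs = []} _ _ = z≤n
unique-⊆⇒length-≤ {xs = x ∷ xs} {ys} (x∉xs ∷ xs-unique) xs⊆ys = begin
  suc (length xs)               ≤⟨ s≤s (unique-⊆⇒length-≤ xs-unique λ z∈xs →
                                     ∈-─⁺ x∈ys (xs⊆ys (there z∈xs)) λ { refl → All.lookup x∉xs z∈xs refl }) ⟩
  suc (length (ys ─ x∈ys))      ≡⟨ sym (length-removeAt′ ys (index x∈ys)) ⟩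
  length ys                     ∎
  where
  open ≤-Reasoning
  x∈ys = xs⊆ys (here refl)

hasCount-unique : ∀ {n k k'} → HasCount n k → HasCount n k' → k ≡ k'
hasCount-unique (xs , xs-unique , ∈xs⇔ , refl) (ys , ys-unique , ∈ys⇔ , refl) = ≤-antisym
  (unique-⊆⇒length-≤ xs-unique λ {z} z∈xs → Equivalence.from (∈ys⇔ z) (Equivalence.to (∈xs⇔ z) z∈xs))
  (unique-⊆⇒length-≤ ys-unique λ {z} z∈ys → Equivalence.from (∈xs⇔ z) (Equivalence.to (∈ys⇔ z) z∈ys))

permutation-good : Valid n c → Good (permutation n c)
permutation-good {n} {c} v =
  represents-isPerm {w = permutation n c} rep (⟦⟧-injective v) ,
  avoidsAll {w = permutation n c} rep (proj₂ (⟦⟧-inversionsThrough c))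
  where rep = permutation-represents v

good⇒permutation : ∀ {w : Vec (Fin n) n} → Good w → ∃ λ c → Valid n c × w ≡ permutation n c
good⇒permutation {w = w} good with Classification.classification (goodFunction good)
... | c , v , agrees = c , v , represents-≡ (valueAt-represents w) (permutation-represents v) agrees

permutation-injective : ∀ {c c'} → Valid n c → Valid n c' → permutation n c ≡ permutation n c' → c ≡ c'
permutation-injective {n} {c} {c'} v v' eq = shape-injective v v' λ k k<n → begin
  ⟦ c ⟧ k                                      ≡⟨ cong ⟦ c ⟧ (sym (toℕ-fromℕ< k<n)) ⟩
  ⟦ c ⟧ (toℕ (fromℕ< k<n))                     ≡⟨ sym (permutation-represents v (fromℕ< k<n)) ⟩
  toℕ (lookup (permutation n c) (fromℕ< k<n))  ≡⟨ cong (λ w → toℕ (lookup w (fromℕ< k<n))) eq ⟩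
  toℕ (lookup (permutation n c') (fromℕ< k<n)) ≡⟨ permutation-represents v' (fromℕ< k<n) ⟩
  ⟦ c' ⟧ (toℕ (fromℕ< k<n))                    ≡⟨ cong ⟦ c' ⟧ (toℕ-fromℕ< k<n) ⟩
  ⟦ c' ⟧ k                                     ∎
  where open ≡-Reasoning

goodPermutations : ∀ n → List (Vec (Fin n) n)
goodPermutations n = map (permutation n) (shapes n)

shapes-valid : ∀ n → All (Valid n) (shapes n)
shapes-valid n = identity ∷ All.tabulate ∈-rotations⁻

∈-shapes⁺ : Valid n c → c ∈ shapes n
∈-shapes⁺ identity = here refl
∈-shapes⁺ v@(left _ _) = there (∈-rotations⁺ v)
∈-shapes⁺ v@(right _ _) = there (∈-rotations⁺ v)

∈-goodPermutations⇔ : ∀ n w → w ∈ goodPermutations n ⇔ Good w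
∈-goodPermutations⇔ n w = mk⇔ to from
  where
  to : w ∈ goodPermutations n → Good w
  to w∈ with ∈-map⁻ (permutation n) w∈
  ... | c , c∈ , refl = permutation-good (All.lookup (shapes-valid n) c∈)
  from : Good w → w ∈ goodPermutations n
  from good with good⇒permutation {w = w} good
  ... | c , v , refl = ∈-map⁺ (permutation n) (∈-shapes⁺ v)

goodPermutations-count : ∀ m → HasCount (suc m) (m * m + 1)
goodPermutations-count m =
  goodPermutations (suc m) ,
  unique-map⁺ permutation-injective (shapes-valid (suc m)) (shapes-unique (suc m)) ,
  ∈-goodPermutations⇔ (suc m) ,
  trans (length-map (permutation (suc m)) (shapes (suc m))) (trans (cong suc (length-rotations m)) (+-comm 1 (m * m)))

square-recurrence : ∀ m → (3 + m) * (3 + m) + 1 + 3 * ((1 + m) * (1 + m) + 1) ≡ 3 * ((2 + m) * (2 + m) + 1) + (m * m + 1)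
square-recurrence = solve-∀

recurrence-of-squares : ∀ (α : ℕ → ℕ) → (∀ k → α (suc k) ≡ k * k + 1) →
                        ∀ n → n ≥ 3 → α (suc n) + 3 * α (n ∸ 1) ≡ 3 * α n + α (n ∸ 2)
recurrence-of-squares α α-closed (suc (suc (suc m))) (s≤s (s≤s (s≤s _))) = begin
  α (4 + m) + 3 * α (2 + m)                           ≡⟨ cong₂ (λ a b → a + 3 * b) (α-closed (3 + m)) (α-closed (1 + m)) ⟩
  (3 + m) * (3 + m) + 1 + 3 * ((1 + m) * (1 + m) + 1) ≡⟨ square-recurrence m ⟩
  3 * ((2 + m) * (2 + m) + 1) + (m * m + 1)           ≡⟨ sym (cong₂ (λ a b → 3 * a + b) (α-closed (2 + m)) (α-closed m)) ⟩
  3 * α (3 + m) + α (1 + m)                           ∎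
  where open ≡-Reasoning

mainTheorem5 : (∀ n → n ≥ 1 → HasCount n ((n ∸ 1) * (n ∸ 1) + 1))
    × (∀ (α : ℕ → ℕ) → (∀ n → n ≥ 1 → HasCount n (α n))
      → ∀ n → n ≥ 3 → α (suc n) + 3 * α (n ∸ 1) ≡ 3 * α n + α (n ∸ 2))
mainTheorem5 = count , λ α α-counts → recurrence-of-squares α λ k →
  hasCount-unique (α-counts (suc k) (s≤s z≤n)) (goodPermutations-count k)
  where
  count : ∀ n → n ≥ 1 → HasCount n ((n ∸ 1) * (n ∸ 1) + 1)
  count (suc m) _ = goodPermutations-count m
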